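{- Let $p$ be a prime, let $d\geq1$ be an integer and let $w>2d-1$ be a rational number. Write $w=a/b$ with integers $a,b\geq1$, and $a=p^ma'$ with integers $a'\geq1$, $m\geq0$ and $\gcd(a',p)=1$. Then there exist a strictly increasing sequence of positive integers $(k_j)_{j\geq1}$, a sequence of integers $(n_j)_{j\geq1}$ and a sequence of rational numbers $(u_j)_{j\geq1}$ such that for every $j\geq1$: $n_j\geq3$; $u_j=a_j/b_j$ with integers $a_j,b_j\geq1$, $\gcd(a_j,p)=1$ and $p^m\mid b_j$; and \[ 2d-1<\min\Bigl\{w,\ u_j,\ \frac{p^{k_j}}{w\,u_j^{n_j-2}}\Bigr\},\qquad \max\Bigl\{w,\ u_j,\ \frac{p^{k_j}}{w\,u_j^{n_j-2}}\Bigr\}=w . \] -}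

module Defs where

open import Data.Nat using (ℕ; zero; suc)
open import Data.Rational using (ℚ; 0ℚ; 1ℚ; _*_; _÷_; ≢-nonZero)
open import Data.Rational.Properties using (_≟_)
open import Relation.Nullary using (yes; no)

_^ℚ_ : ℚ → ℕ → ℚ
q ^ℚ zero  = 1ℚ
q ^ℚ suc n = q * (q ^ℚ n)

-- total division on ℚ (x / 0 := 0); only ever used with a nonzero
-- (indeed positive) denominator in the statement, where it agrees with _÷_
_/ℚ_ : ℚ → ℚ → ℚ
x /ℚ y with y ≟ 0ℚ
... | yes _  = 0ℚ
... | no y≢0 = _÷_ x y {{≢-nonZero y≢0}}

module Submission where

-- Write w = A / B and L = 2d − 1 < w, and let K = k_{j−1}. Fix a large exponent N and a
-- large power D of p (so that p ^ m ∣ D). First choose k > K with p ^ k B² just above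
-- A² L ^ N, within a factor p ^ (K + 1). Then walk along the numerators c = 1 + i p, all
-- prime to p, up to the first one for which t = p ^ k / (w u ^ N) ≤ w, where u = c / D.
-- There u > L because p ^ k B² > A² L ^ N; t > L because, by a Bernoulli-type estimate,
-- the N-th powers of consecutive grid points differ by a factor less than w / L; and
-- u ≤ w because otherwise the previous grid point would already be at least
-- (1 + 1/(2LB)) L, whose N-th power exceeds p ^ (K + 1) L ^ N. Then n = N + 2.

open import Defs
open import Data.Nat using (ℕ; suc; _≤_; _<_; _^_; _∸_; _*_)
open import Data.Nat.Divisibility using (_∣_)
open import Data.Nat.GCD using (gcd)
open import Data.Nat.Primality using (Prime)
open import Data.Integer using (+_)
open import Data.Rational using (ℚ; _/_; _⊓_; _⊔_) renaming (_<_ to _<ℚ_; _*_ to _*ℚ_)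
open import Data.Product using (Σ; _×_; ∃-syntax)
open import Relation.Binary.PropositionalEquality using (_≡_)

open import Data.Nat using (zero; pred; _+_; _>_; _≤?_; _<?_; z≤n; s≤s; z<s; NonZero; >-nonZero; >-nonZero⁻¹; nonTrivial⇒n>1)
open import Data.Nat.Properties
open import Data.Nat.Tactic.RingSolver using (solve-∀)
open import Data.Nat.Divisibility using (∣-trans; ∣m+n∣m⇒∣n; n∣m*n; m∣m*n; ∣1⇒≡1)
open import Data.Nat.GCD using (gcd[m,n]∣m; gcd[m,n]∣n)
open import Data.Nat.Primality using (prime⇒nonTrivial)
import Data.Integer as ℤ
import Data.Integer.Properties as ℤ
open import Data.Rational using (0ℚ; toℚᵘ; Positive; positive; ≢-nonZero) renaming (_≤_ to _≤ℚ_)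
import Data.Rational.Properties as ℚ
open import Data.Rational.Unnormalised as ℚᵘ using (mkℚᵘ; ↥_; ↧_; _≃_; *≤*; *<*)
import Data.Rational.Unnormalised.Properties as ℚᵘ
open import Data.Product using (_,_)
open import Data.Sum using (inj₁; inj₂)
open import Data.Empty using (⊥-elim)
open import Function using (_∘_; it)
open import Relation.Nullary using (¬_; yes; no; contradiction)
open import Relation.Unary using (Decidable)
open import Relation.Binary.PropositionalEquality using (refl; sym; trans; cong; cong₂; subst; subst₂; _≢_; module ≡-Reasoning)

^-distribʳ-* : ∀ m n o → (m * n) ^ o ≡ m ^ o * n ^ o
^-distribʳ-* m n zero    = refl
^-distribʳ-* m n (suc o) = begin
  m * n * (m * n) ^ o      ≡⟨ cong (m * n *_) (^-distribʳ-* m n o) ⟩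
  m * n * (m ^ o * n ^ o)  ≡⟨ [m*n]*[o*p]≡[m*o]*[n*p] m n (m ^ o) (n ^ o) ⟩
  m ^ suc o * n ^ suc o    ∎
  where open ≡-Reasoning

n<m^n : ∀ {m} → 1 < m → ∀ n → n < m ^ n
n<m^n     1<m zero    = z<s
n<m^n {m} 1<m (suc n) = ≤-<-trans (n<m^n 1<m n) (^-monoʳ-< m 1<m (n<1+n n))

x^n*[x+n]≤[1+x]^n*x : ∀ x n → x ^ n * (x + n) ≤ (1 + x) ^ n * x
x^n*[x+n]≤[1+x]^n*x x zero    = ≤-reflexive (cong (1 *_) (+-identityʳ x))
x^n*[x+n]≤[1+x]^n*x x (suc n) = begin
  x * x ^ n * (x + suc n)                 ≤⟨ m≤m+n _ (x ^ n * n) ⟩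
  x * x ^ n * (x + suc n) + x ^ n * n     ≡⟨ regroup x n (x ^ n) ⟩
  (1 + x) * (x ^ n * (x + n))             ≤⟨ *-monoʳ-≤ (1 + x) (x^n*[x+n]≤[1+x]^n*x x n) ⟩
  (1 + x) * ((1 + x) ^ n * x)             ≡⟨ *-assoc (1 + x) ((1 + x) ^ n) x ⟨
  (1 + x) * (1 + x) ^ n * x               ∎
  where
  open ≤-Reasoning
  regroup : ∀ x n a → x * a * (x + suc n) + a * n ≡ (1 + x) * (a * (x + n))
  regroup = solve-∀

M*a^[x*M]≤b^[x*M] : ∀ {x a b} M .{{_ : NonZero x}} →
                    (1 + x) * a ≤ x * b → M * a ^ (x * M) ≤ b ^ (x * M)
M*a^[x*M]≤b^[x*M] {x} {a} {b} M [1+x]a≤xb = *-cancelˡ-≤ (x ^ n) {{m^n≢0 x n}} (begin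
  x ^ n * (M * a ^ n)  ≡⟨ x*[y*z]≡y*x*z (x ^ n) M (a ^ n) ⟩
  M * x ^ n * a ^ n    ≤⟨ *-monoˡ-≤ (a ^ n) M*xⁿ≤[1+x]ⁿ ⟩
  (1 + x) ^ n * a ^ n  ≡⟨ ^-distribʳ-* (1 + x) a n ⟨
  ((1 + x) * a) ^ n    ≤⟨ ^-monoˡ-≤ n [1+x]a≤xb ⟩
  (x * b) ^ n          ≡⟨ ^-distribʳ-* x b n ⟩
  x ^ n * b ^ n        ∎)
  where
  open ≤-Reasoning
  n = x * M
  x*[y*z]≡y*x*z : ∀ x y z → x * (y * z) ≡ y * x * z
  x*[y*z]≡y*x*z = solve-∀
  M*xⁿ≤[1+x]ⁿ : M * x ^ n ≤ (1 + x) ^ n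
  M*xⁿ≤[1+x]ⁿ = *-cancelˡ-≤ x (begin
    x * (M * x ^ n)  ≡⟨ x*[M*y]≡y*[x*M] x M (x ^ n) ⟩
    x ^ n * n        ≤⟨ *-monoʳ-≤ (x ^ n) (m≤n+m n x) ⟩
    x ^ n * (x + n)  ≤⟨ x^n*[x+n]≤[1+x]^n*x x n ⟩
    (1 + x) ^ n * x  ≡⟨ *-comm ((1 + x) ^ n) x ⟩
    x * (1 + x) ^ n  ∎)
    where
    x*[M*y]≡y*[x*M] : ∀ x M y → x * (M * y) ≡ y * (x * M)
    x*[M*y]≡y*[x*M] = solve-∀

[x+y]^n*[x+y]≤x^n*[x+y]+n*y*[x+y]^n : ∀ x y n →
  (x + y) ^ n * (x + y) ≤ x ^ n * (x + y) + n * y * (x + y) ^ n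
[x+y]^n*[x+y]≤x^n*[x+y]+n*y*[x+y]^n x y zero =
  ≤-reflexive (sym (+-identityʳ (1 * (x + y))))
[x+y]^n*[x+y]≤x^n*[x+y]+n*y*[x+y]^n x y (suc n) = begin
  s * s ^ n * s                                   ≡⟨ *-assoc s (s ^ n) s ⟩
  s * (s ^ n * s)                                 ≤⟨ *-monoʳ-≤ s ([x+y]^n*[x+y]≤x^n*[x+y]+n*y*[x+y]^n x y n) ⟩
  s * (x ^ n * s + n * y * s ^ n)                 ≡⟨ expand x y (x ^ n) (s ^ n) n ⟩
  x * x ^ n * s + (y * (x ^ n * s) + n * y * (s * s ^ n))
    ≤⟨ +-monoʳ-≤ (x * x ^ n * s) (+-monoˡ-≤ (n * y * (s * s ^ n)) (*-monoʳ-≤ y xⁿs≤sⁿs)) ⟩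
  x * x ^ n * s + (y * (s ^ n * s) + n * y * (s * s ^ n))
                                                  ≡⟨ cong (λ z → x * x ^ n * s + z) (collect x y (s ^ n) n) ⟩
  x * x ^ n * s + suc n * y * (s * s ^ n)         ∎
  where
  open ≤-Reasoning
  s = x + y
  xⁿs≤sⁿs : x ^ n * s ≤ s ^ n * s
  xⁿs≤sⁿs = *-monoˡ-≤ s (^-monoˡ-≤ n (m≤m+n x y))
  expand : ∀ x y a b n → (x + y) * (a * (x + y) + n * y * b) ≡
                         x * a * (x + y) + (y * (a * (x + y)) + n * y * ((x + y) * b))
  expand = solve-∀
  collect : ∀ x y b n → y * (b * (x + y)) + n * y * ((x + y) * b) ≡ suc n * y * ((x + y) * b)
  collect = solve-∀

E*[x+y]^n≤[1+E]*x^n : ∀ E x y n .{{_ : NonZero (x + y)}} →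
                      suc E * n * y ≤ x + y → E * (x + y) ^ n ≤ suc E * x ^ n
E*[x+y]^n≤[1+E]*x^n E x y n [1+E]ny≤s = *-cancelʳ-≤ _ _ s (+-cancelʳ-≤ (a * s) _ _ (begin
  E * a * s + a * s               ≡⟨ gather E a s ⟩
  suc E * (a * s)                 ≤⟨ *-monoʳ-≤ (suc E) ([x+y]^n*[x+y]≤x^n*[x+y]+n*y*[x+y]^n x y n) ⟩
  suc E * (b * s + n * y * a)     ≡⟨ spread (suc E) b s n y a ⟩
  suc E * b * s + suc E * n * y * a
                                  ≤⟨ +-monoʳ-≤ (suc E * b * s) (*-monoˡ-≤ a [1+E]ny≤s) ⟩
  suc E * b * s + s * a           ≡⟨ cong (λ z → suc E * b * s + z) (*-comm s a) ⟩
  suc E * b * s + a * s           ∎))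
  where
  open ≤-Reasoning
  s = x + y
  a = s ^ n
  b = x ^ n
  gather : ∀ E a s → E * a * s + a * s ≡ suc E * (a * s)
  gather = solve-∀
  spread : ∀ e b s n y a → e * (b * s + n * y * a) ≡ e * b * s + e * n * y * a
  spread = solve-∀

lower-boundary : ∀ {P : ℕ → Set} → Decidable P → ∀ {n} → P n →
                 ∃[ i ] P i × (∀ {j} → i ≡ suc j → ¬ P j)
lower-boundary P? {zero}  P0   = 0 , P0 , λ ()
lower-boundary P? {suc n} Psn with P? n
... | yes Pn  = lower-boundary P? Pn
... | no  ¬Pn = suc n , Psn , λ { refl → ¬Pn }

power-in-window : ∀ {p} → 1 < p → ∀ K {X Z} .{{_ : NonZero Z}} → Z ≤ X →
                  ∃[ k ] K < k × X < p ^ k * Z × p ^ k * Z ≤ p ^ suc K * X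
power-in-window {p} 1<p K {X} {Z} Z≤X = window (lower-boundary (λ k → p ^ K * X <? p ^ k * Z) {K + X} start)
  where
  instance
    p≢0 : NonZero p
    p≢0 = >-nonZero (<-trans z<s 1<p)
  P : ℕ → Set
  P k = p ^ K * X < p ^ k * Z
  start : P (K + X)
  start = begin-strict
    p ^ K * X        <⟨ *-monoʳ-< (p ^ K) {{m^n≢0 p K}} (n<m^n 1<p X) ⟩
    p ^ K * p ^ X    ≡⟨ ^-distribˡ-+-* p K X ⟨
    p ^ (K + X)      ≤⟨ m≤m*n (p ^ (K + X)) Z ⟩
    p ^ (K + X) * Z  ∎
    where open ≤-Reasoning
  K<k : ∀ {k} → P k → K < k
  K<k Pk = ≰⇒> λ k≤K → <⇒≱ Pk (*-mono-≤ (^-monoʳ-≤ p k≤K) Z≤X)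
  window : (∃[ k ] P k × (∀ {j} → k ≡ suc j → ¬ P j)) →
           ∃[ k ] K < k × X < p ^ k * Z × p ^ k * Z ≤ p ^ suc K * X
  window (zero  , P0 , _)     = contradiction (K<k P0) n≮0
  window (suc k , Pk , below) = suc k , K<k Pk , ≤-<-trans (m≤n*m X (p ^ K) {{m^n≢0 p K}}) Pk ,
    subst₂ _≤_ (sym (*-assoc p (p ^ k) Z)) (sym (*-assoc p (p ^ K) X)) (*-monoʳ-≤ p (≮⇒≥ (below refl)))

gcd[1+i*p,p]≡1 : ∀ i p → gcd (1 + i * p) p ≡ 1
gcd[1+i*p,p]≡1 i p = ∣1⇒≡1 (∣m+n∣m⇒∣n g∣i*p+1 (∣-trans (gcd[m,n]∣n (1 + i * p) p) (n∣m*n i)))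
  where
  g∣i*p+1 : gcd (1 + i * p) p ∣ i * p + 1
  g∣i*p+1 = subst (gcd (1 + i * p) p ∣_) (+-comm 1 (i * p)) (gcd[m,n]∣m (1 + i * p) p)

L*D<c : ∀ L V {D c Z} N .{{_ : NonZero D}} → V * L ^ N < Z → Z * D ^ N ≤ V * c ^ N → L * D < c
L*D<c L V {D} {c} {Z} N VLᴺ<Z ZDᴺ≤Vcᴺ = ≰⇒> λ c≤LD → <⇒≱ (begin-strict
  V * c ^ N            ≤⟨ *-monoʳ-≤ V (^-monoˡ-≤ N c≤LD) ⟩
  V * (L * D) ^ N      ≡⟨ cong (V *_) (^-distribʳ-* L D N) ⟩
  V * (L ^ N * D ^ N)  ≡⟨ *-assoc V (L ^ N) (D ^ N) ⟨
  V * L ^ N * D ^ N    <⟨ *-monoˡ-< (D ^ N) {{m^n≢0 D N}} VLᴺ<Z ⟩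
  Z * D ^ N            ∎) ZDᴺ≤Vcᴺ
  where open ≤-Reasoning

module GridEstimates {L A B : ℕ} .{{_ : NonZero L}} .{{_ : NonZero B}} (L*B<A : L * B < A) where

  E : ℕ
  E = L * B

  instance
    2*E≢0 : NonZero (2 * E)
    2*E≢0 = m*n≢0 2 E {{_}} {{m*n≢0 L B}}

  [1+2E]*[L*D]≤2E*c′ : ∀ {y c′ D} → 2 * y * B ≤ D → A * D < (c′ + y) * B →
                       (1 + 2 * E) * (L * D) ≤ 2 * E * c′
  [1+2E]*[L*D]≤2E*c′ {y} {c′} {D} 2yB≤D AD<[c′+y]B = begin
    (1 + 2 * E) * (L * D)  ≡⟨ swap L (1 + 2 * E) D ⟩
    L * ((1 + 2 * E) * D)  ≤⟨ *-monoʳ-≤ L (+-cancelʳ-≤ (2 * y * B) _ _ (begin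
        (1 + 2 * E) * D + 2 * y * B  ≤⟨ +-monoʳ-≤ ((1 + 2 * E) * D) 2yB≤D ⟩
        (1 + 2 * E) * D + D          ≡⟨ double E D ⟩
        2 * (suc E * D)              ≤⟨ *-monoʳ-≤ 2 (*-monoˡ-≤ D L*B<A) ⟩
        2 * (A * D)                  ≤⟨ *-monoʳ-≤ 2 (<⇒≤ AD<[c′+y]B) ⟩
        2 * ((c′ + y) * B)           ≡⟨ distrib c′ y B ⟩
        2 * c′ * B + 2 * y * B       ∎)) ⟩
    L * (2 * c′ * B)       ≡⟨ regroup L c′ B ⟩
    2 * E * c′             ∎
    where
    open ≤-Reasoning
    swap : ∀ L a D → a * (L * D) ≡ L * (a * D)
    swap = solve-∀
    double : ∀ E D → (1 + 2 * E) * D + D ≡ 2 * (suc E * D)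
    double = solve-∀
    distrib : ∀ c y B → 2 * ((c + y) * B) ≡ 2 * c * B + 2 * y * B
    distrib = solve-∀
    regroup : ∀ L c B → L * (2 * c * B) ≡ 2 * (L * B) * c
    regroup = solve-∀

  [c′+y]*B≤A*D : ∀ {y c′ D Z} M → 2 * y * B ≤ D →
                 A * A * c′ ^ (2 * E * M) < Z * D ^ (2 * E * M) →
                 Z ≤ M * (A * A * L ^ (2 * E * M)) → (c′ + y) * B ≤ A * D
  [c′+y]*B≤A*D {y} {c′} {D} {Z} M 2yB≤D A²c′ᴺ<ZDᴺ Z≤MA²Lᴺ = ≮⇒≥ λ AD<[c′+y]B →
    <⇒≱ A²c′ᴺ<ZDᴺ (begin
      Z * D ^ N                       ≤⟨ *-monoˡ-≤ (D ^ N) Z≤MA²Lᴺ ⟩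
      M * (A * A * L ^ N) * D ^ N     ≡⟨ regroup M (A * A) (L ^ N) (D ^ N) ⟩
      A * A * (M * (L ^ N * D ^ N))   ≡⟨ cong (λ t → A * A * (M * t)) (^-distribʳ-* L D N) ⟨
      A * A * (M * (L * D) ^ N)       ≤⟨ *-monoʳ-≤ (A * A)
                                           (M*a^[x*M]≤b^[x*M] {2 * E} {L * D} {c′} M
                                             ([1+2E]*[L*D]≤2E*c′ {y} 2yB≤D AD<[c′+y]B)) ⟩
      A * A * c′ ^ N                  ∎)
    where
    open ≤-Reasoning
    N = 2 * E * M
    regroup : ∀ M a l d → M * (a * l) * d ≡ a * (M * (l * d))
    regroup = solve-∀

  -- (c′ + y) ^ N / c′ ^ N ≤ (E + 1) / E ≤ A / E, i.e. at most w / L.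
  L*A*[c′+y]^N<W*D^N : ∀ {y c′ D W} N .{{_ : NonZero (c′ + y)}} → suc E * N * y ≤ c′ + y →
                       A * A * c′ ^ N < W * B * D ^ N → L * A * (c′ + y) ^ N < W * D ^ N
  L*A*[c′+y]^N<W*D^N {y} {c′} {D} {W} N [1+E]Ny≤c A²c′ᴺ<WBDᴺ = *-cancelʳ-< B _ _ (begin-strict
    L * A * c ^ N * B      ≡⟨ regroup L A (c ^ N) B ⟩
    A * (E * c ^ N)        ≤⟨ *-monoʳ-≤ A (E*[x+y]^n≤[1+E]*x^n E c′ y N [1+E]Ny≤c) ⟩
    A * (suc E * c′ ^ N)   ≤⟨ *-monoʳ-≤ A (*-monoˡ-≤ (c′ ^ N) L*B<A) ⟩
    A * (A * c′ ^ N)       ≡⟨ *-assoc A A (c′ ^ N) ⟨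
    A * A * c′ ^ N         <⟨ A²c′ᴺ<WBDᴺ ⟩
    W * B * D ^ N          ≡⟨ swap W B (D ^ N) ⟩
    W * D ^ N * B          ∎)
    where
    open ≤-Reasoning
    c = c′ + y
    regroup : ∀ L A a B → L * A * a * B ≡ A * (L * B * a)
    regroup = solve-∀
    swap : ∀ W B d → W * B * d ≡ W * d * B
    swap = solve-∀

grid : ℕ → ℕ → ℕ
grid p i = 1 + i * p

grid-crossing : ∀ p V Y N .{{_ : NonZero p}} .{{_ : NonZero V}} → N > 0 →
                ∃[ i ] Y ≤ V * grid p i ^ N × (∀ {i′} → i ≡ suc i′ → V * grid p i′ ^ N < Y)
grid-crossing p V Y N N>0 with lower-boundary (λ i → Y ≤? V * grid p i ^ N) {Y} Y≤V*grid[Y]ᴺ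
  where
  Y≤V*grid[Y]ᴺ : Y ≤ V * grid p Y ^ N
  Y≤V*grid[Y]ᴺ = begin
    Y                  ≤⟨ m≤m*n Y p ⟩
    Y * p              ≤⟨ n≤1+n (Y * p) ⟩
    grid p Y           ≡⟨ *-identityʳ (grid p Y) ⟨
    grid p Y ^ 1       ≤⟨ ^-monoʳ-≤ (grid p Y) N>0 ⟩
    grid p Y ^ N       ≤⟨ m≤n*m (grid p Y ^ N) V ⟩
    V * grid p Y ^ N   ∎
    where open ≤-Reasoning
... | i , Y≤ , below = i , Y≤ , λ eq → ≰⇒> (below eq)

grid-suc : ∀ p i → grid p (suc i) ≡ grid p i + p
grid-suc p i = cong suc (+-comm p (i * p))

module Construction {p : ℕ} (1<p : 1 < p) (m : ℕ) {L A B : ℕ} .{{_ : NonZero L}} .{{_ : NonZero B}}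
                    (L*B<A : L * B < A) where

  open GridEstimates L*B<A

  instance
    p≢0 : NonZero p
    p≢0 = >-nonZero (<-trans z<s 1<p)
    A*A≢0 : NonZero (A * A)
    A*A≢0 = m*n≢0 A A {{A≢0}} {{A≢0}}
      where
      A≢0 : NonZero A
      A≢0 = >-nonZero (<-≤-trans z<s L*B<A)
    B*B≢0 : NonZero (B * B)
    B*B≢0 = m*n≢0 B B

  -- With w = A / B, u = c / D and t = p ^ k / (w u ^ N), the last four fields
  -- say L < u ≤ w and L < t ≤ w, cross-multiplied.
  record Step (K : ℕ) : Set where
    field
      k N c D    : ℕ
      K<k        : K < k
      N>0        : N > 0
      D>0        : D > 0
      pᵐ∣D       : p ^ m ∣ D
      gcd[c,p]≡1 : gcd c p ≡ 1
      L<u        : L * D < c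
      u≤w        : c * B ≤ A * D
      L<t        : L * A * c ^ N < p ^ k * B * D ^ N
      t≤w        : p ^ k * (B * B) * D ^ N ≤ A * A * c ^ N

  -- N is chosen so that (1 + 1/(2E)) ^ N ≥ p ^ (K + 1); D ≥ T makes the step p / D between
  -- the candidates u = (1 + i p) / D small compared with 1 / B and with u / ((E + 1) N).
  module Level (K : ℕ) where

    N T D X : ℕ
    N = 2 * E * p ^ suc K
    T = suc E * N * p + 2 * p * B
    D = p ^ (m + T)
    X = A * A * L ^ N

    instance
      D≢0 : NonZero D
      D≢0 = m^n≢0 p (m + T)

    N>0 : N > 0
    N>0 = >-nonZero⁻¹ N {{m*n≢0 (2 * E) (p ^ suc K) {{2*E≢0}} {{m^n≢0 p (suc K)}}}}

    T≤D : T ≤ D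
    T≤D = ≤-trans (<⇒≤ (n<m^n 1<p T)) (^-monoʳ-≤ p (m≤n+m T m))

    pᵐ∣D : p ^ m ∣ D
    pᵐ∣D = subst (p ^ m ∣_) (sym (^-distribˡ-+-* p m T)) (m∣m*n (p ^ T))

    B*B≤X : B * B ≤ X
    B*B≤X = ≤-trans (*-mono-≤ B≤A B≤A) (m≤m*n (A * A) (L ^ N) {{m^n≢0 L N}})
      where
      B≤A : B ≤ A
      B≤A = ≤-trans (m≤n*m B L) (<⇒≤ L*B<A)

    not-crossed-at-0 : ∀ {Z} → X < Z → ¬ Z * D ^ N ≤ A * A * grid p 0 ^ N
    not-crossed-at-0 X<Z crossed =
      contradiction (>-nonZero⁻¹ (L * D) {{m*n≢0 L D}}) (<⇒≱ (L*D<c L (A * A) N X<Z crossed))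

    module Crossing {k i : ℕ} (K<k : K < k)
                    (X<Z : X < p ^ k * (B * B)) (Z≤pX : p ^ k * (B * B) ≤ p ^ suc K * X)
                    (crossed : p ^ k * (B * B) * D ^ N ≤ A * A * grid p (suc i) ^ N)
                    (not-yet : A * A * grid p i ^ N < p ^ k * (B * B) * D ^ N) where

      c′ c : ℕ
      c′ = grid p i
      c  = c′ + p

      t≤w : p ^ k * (B * B) * D ^ N ≤ A * A * c ^ N
      t≤w = subst (λ c → p ^ k * (B * B) * D ^ N ≤ A * A * c ^ N) (grid-suc p i) crossed

      L<u : L * D < c
      L<u = L*D<c L (A * A) N X<Z t≤w

      u≤w : c * B ≤ A * D
      u≤w = [c′+y]*B≤A*D (p ^ suc K) (≤-trans (m≤n+m (2 * p * B) (suc E * N * p)) T≤D) not-yet Z≤pX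

      L<t : L * A * c ^ N < p ^ k * B * D ^ N
      L<t = L*A*[c′+y]^N<W*D^N {W = p ^ k * B} N [1+E]Np≤c
              (subst (λ Z → A * A * c′ ^ N < Z * D ^ N) (sym (*-assoc (p ^ k) B B)) not-yet)
        where
        [1+E]Np≤c : suc E * N * p ≤ c
        [1+E]Np≤c = ≤-trans (m≤m+n (suc E * N * p) (2 * p * B)) (≤-trans T≤D (≤-trans (m≤n*m D L) (<⇒≤ L<u)))

      step : Step K
      step = record
        { k = k ; N = N ; c = c ; D = D
        ; K<k = K<k ; N>0 = N>0 ; D>0 = >-nonZero⁻¹ D ; pᵐ∣D = pᵐ∣D
        ; gcd[c,p]≡1 = subst (λ c → gcd c p ≡ 1) (grid-suc p i) (gcd[1+i*p,p]≡1 (suc i) p)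
        ; L<u = L<u ; u≤w = u≤w ; L<t = L<t ; t≤w = t≤w
        }

  -- Opaque: unfolding the construction during conversion checking is infeasible.
  opaque
    step : ∀ K → Step K
    step K with power-in-window 1<p K (Level.B*B≤X K)
    ... | k , K<k , X<Z , Z≤pX
        with grid-crossing p (A * A) (p ^ k * (B * B) * Level.D K ^ Level.N K) (Level.N K) (Level.N>0 K)
    ... | zero  , crossed , _     = contradiction crossed (Level.not-crossed-at-0 K X<Z)
    ... | suc i , crossed , below = Level.Crossing.step K {i = i} K<k X<Z Z≤pX crossed (below refl)

pos-*-pos : ∀ {a b n e} → a ≡ + n → b ≡ + e → a ℤ.* b ≡ + (n * e)
pos-*-pos {n = n} {e} refl refl = sym (ℤ.pos-* n e)

-- Frac q n d: q equals the (not necessarily reduced) fraction n / d.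
Frac : ℚ → ℕ → ℕ → Set
Frac q n d = ∃[ z ] toℚᵘ q ≃ z × ↥ z ≡ + n × ↧ z ≡ + d

frac-/ : ∀ n d → Frac (+ n / suc d) n (suc d)
frac-/ n d = mkℚᵘ (+ n) d , ℚ.toℚᵘ-fromℚᵘ (mkℚᵘ (+ n) d) , refl , refl

frac-* : ∀ {x y n d m e} → Frac x n d → Frac y m e → Frac (x *ℚ y) (n * m) (d * e)
frac-* {x} {y} (z@(mkℚᵘ _ _) , x≃z , ↥z , ↧z) (z′@(mkℚᵘ _ _) , y≃z′ , ↥z′ , ↧z′) =
  z ℚᵘ.* z′ ,
  ℚᵘ.≃-trans (ℚ.toℚᵘ-homo-* x y) (ℚᵘ.*-cong x≃z y≃z′) ,
  pos-*-pos ↥z ↥z′ ,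
  cong +_ (cong₂ _*_ (ℤ.+-injective ↧z) (ℤ.+-injective ↧z′))

frac-^ℚ : ∀ {x n d} → Frac x n d → ∀ N → Frac (x ^ℚ N) (n ^ N) (d ^ N)
frac-^ℚ x≈n/d zero    = frac-/ 1 0
frac-^ℚ x≈n/d (suc N) = frac-* x≈n/d (frac-^ℚ x≈n/d N)

frac-≤ : ∀ {x y n d m e} → Frac x n d → Frac y m e → n * e ≤ m * d → x ≤ℚ y
frac-≤ (z , x≃z , ↥z , ↧z) (z′ , y≃z′ , ↥z′ , ↧z′) ne≤md = ℚ.toℚᵘ-cancel-≤
  (ℚᵘ.≤-respˡ-≃ (ℚᵘ.≃-sym x≃z) (ℚᵘ.≤-respʳ-≃ (ℚᵘ.≃-sym y≃z′)
    (*≤* (subst₂ ℤ._≤_ (sym (pos-*-pos ↥z ↧z′)) (sym (pos-*-pos ↥z′ ↧z)) (ℤ.+≤+ ne≤md)))))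

frac-< : ∀ {x y n d m e} → Frac x n d → Frac y m e → n * e < m * d → x <ℚ y
frac-< (z , x≃z , ↥z , ↧z) (z′ , y≃z′ , ↥z′ , ↧z′) ne<md = ℚ.toℚᵘ-cancel-<
  (ℚᵘ.<-respˡ-≃ (ℚᵘ.≃-sym x≃z) (ℚᵘ.<-respʳ-≃ (ℚᵘ.≃-sym y≃z′)
    (*<* (subst₂ ℤ._<_ (sym (pos-*-pos ↥z ↧z′)) (sym (pos-*-pos ↥z′ ↧z)) (ℤ.+<+ ne<md)))))

frac-<⁻¹ : ∀ {x y n d m e} → Frac x n d → Frac y m e → x <ℚ y → n * e < m * d
frac-<⁻¹ (z , x≃z , ↥z , ↧z) (z′ , y≃z′ , ↥z′ , ↧z′) x<y = ℤ.drop‿+<+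
  (subst₂ ℤ._<_ (pos-*-pos ↥z ↧z′) (pos-*-pos ↥z′ ↧z)
    (ℚᵘ.drop-*<* (ℚᵘ.<-respˡ-≃ x≃z (ℚᵘ.<-respʳ-≃ y≃z′ (ℚ.toℚᵘ-mono-< x<y)))))

[x/y]*y≡x : ∀ x y → y ≢ 0ℚ → (x /ℚ y) *ℚ y ≡ x
[x/y]*y≡x x y y≢0 with y ℚ.≟ 0ℚ
... | yes y≡0 = ⊥-elim (y≢0 y≡0)
... | no  y≢0 = trans (ℚ.*-assoc x _ y) (trans (cong (x *ℚ_) (ℚ.*-inverseˡ y {{≢-nonZero y≢0}})) (ℚ.*-identityʳ x))

x<y⇒x<z⇒x<y⊓z : ∀ {l a b} → l <ℚ a → l <ℚ b → l <ℚ a ⊓ b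
x<y⇒x<z⇒x<y⊓z {l} {a} {b} l<a l<b with ℚ.⊓-sel a b
... | inj₁ a⊓b≡a = subst (l <ℚ_) (sym a⊓b≡a) l<a
... | inj₂ a⊓b≡b = subst (l <ℚ_) (sym a⊓b≡b) l<b

y≤x⇒z≤x⇒x⊔y⊔z≡x : ∀ {a b c} → b ≤ℚ a → c ≤ℚ a → a ⊔ b ⊔ c ≡ a
y≤x⇒z≤x⇒x⊔y⊔z≡x {a} b≤a c≤a = trans (cong (_⊔ _) (ℚ.p≥q⇒p⊔q≡p b≤a)) (ℚ.p≥q⇒p⊔q≡p c≤a)

module Quotient {w u : ℚ} {A B c D : ℕ} .{{_ : NonZero A}} .{{_ : NonZero c}}
                (w≈A/B : Frac w A B) (u≈c/D : Frac u c D) (P N : ℕ) where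

  y : ℚ
  y = w *ℚ u ^ℚ N

  t : ℚ
  t = (+ P / 1) /ℚ y

  y≈ : Frac y (A * c ^ N) (B * D ^ N)
  y≈ = frac-* w≈A/B (frac-^ℚ u≈c/D N)

  instance
    y-pos : Positive y
    y-pos = positive (frac-< (frac-/ 0 0) y≈ (>-nonZero⁻¹ _ {{Acᴺ≢0}}))
      where
      Acᴺ≢0 : NonZero (A * c ^ N * 1)
      Acᴺ≢0 = m*n≢0 (A * c ^ N) 1 {{m*n≢0 A (c ^ N) {{it}} {{m^n≢0 c N}}}}

  t*y≡P : t *ℚ y ≡ + P / 1
  t*y≡P = [x/y]*y≡x (+ P / 1) y (ℚ.<⇒≢ (ℚ.positive⁻¹ y) ∘ sym)

  L<t : ∀ L → L * A * c ^ N < P * B * D ^ N → + L / 1 <ℚ t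
  L<t L LAcᴺ<PBDᴺ = ℚ.*-cancelʳ-<-nonNeg y {{ℚ.pos⇒nonNeg y}}
    (subst ((+ L / 1) *ℚ y <ℚ_) (sym t*y≡P) (frac-< (frac-* (frac-/ L 0) y≈) (frac-/ P 0)
      (subst₂ _<_ (L*A*x≡L*[A*x]*1 L A (c ^ N)) (P*B*d≡P*[1*[B*d]] P B (D ^ N)) LAcᴺ<PBDᴺ)))
    where
    L*A*x≡L*[A*x]*1 : ∀ L A x → L * A * x ≡ L * (A * x) * 1
    L*A*x≡L*[A*x]*1 = solve-∀
    P*B*d≡P*[1*[B*d]] : ∀ P B d → P * B * d ≡ P * (1 * (B * d))
    P*B*d≡P*[1*[B*d]] = solve-∀

  t≤w : P * (B * B) * D ^ N ≤ A * A * c ^ N → t ≤ℚ w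
  t≤w PB²Dᴺ≤A²cᴺ = ℚ.*-cancelʳ-≤-pos y
    (subst (_≤ℚ w *ℚ y) (sym t*y≡P) (frac-≤ (frac-/ P 0) (frac-* w≈A/B y≈)
      (subst₂ _≤_ (P*[B*B]*d≡P*[B*[B*d]] P B (D ^ N)) (A*A*x≡A*[A*x]*1 A (c ^ N)) PB²Dᴺ≤A²cᴺ)))
    where
    P*[B*B]*d≡P*[B*[B*d]] : ∀ P B d → P * (B * B) * d ≡ P * (B * (B * d))
    P*[B*B]*d≡P*[B*[B*d]] = solve-∀
    A*A*x≡A*[A*x]*1 : ∀ A x → A * A * x ≡ A * (A * x) * 1
    A*A*x≡A*[A*x]*1 = solve-∀

lemma3p12 : (p d : ℕ) → Prime p → 1 ≤ d → (w : ℚ) → (+ (2 * d ∸ 1) / 1) <ℚ w →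
    (a b : ℕ) → 1 ≤ a → 1 ≤ b → w ≡ (+ a / suc (b ∸ 1)) →
    (m a′ : ℕ) → 1 ≤ a′ → a ≡ p ^ m * a′ → gcd a′ p ≡ 1 →
    Σ (ℕ → ℕ) λ k → Σ (ℕ → ℕ) λ n → Σ (ℕ → ℚ) λ u →
      ((∀ j → 1 ≤ j → 1 ≤ k j × k j < k (suc j)) ×
       (∀ j → 1 ≤ j →
          3 ≤ n j ×
          (Σ ℕ λ aj → Σ ℕ λ bj → (1 ≤ aj × 1 ≤ bj × u j ≡ (+ aj / suc (bj ∸ 1)) × gcd aj p ≡ 1 × p ^ m ∣ bj)) ×
          ((+ (2 * d ∸ 1) / 1) <ℚ (w ⊓ u j ⊓ ((+ (p ^ k j) / 1) /ℚ (w *ℚ (u j ^ℚ (n j ∸ 2))))) ×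
          (w ⊔ u j ⊔ ((+ (p ^ k j) / 1) /ℚ (w *ℚ (u j ^ℚ (n j ∸ 2))))) ≡ w)))
-- Only m enters the construction.
lemma3p12 p d p-prime d≥1 w L<w a b a≥1 b≥1 refl m _ _ _ _ = k , n , u , k-increasing , properties
  where
  L B : ℕ
  L = 2 * d ∸ 1
  B = suc (b ∸ 1)
  instance
    L≢0 : NonZero L
    L≢0 = >-nonZero (m<n⇒0<n∸m (*-monoʳ-≤ 2 d≥1))
    a≢0 : NonZero a
    a≢0 = >-nonZero a≥1
  w≈a/B : Frac w a B
  w≈a/B = frac-/ a (b ∸ 1)
  L*B<a : L * B < a
  L*B<a = subst (L * B <_) (*-identityʳ a) (frac-<⁻¹ (frac-/ L 0) w≈a/B L<w)
  open Construction (nonTrivial⇒n>1 p {{prime⇒nonTrivial p-prime}}) m L*B<a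
  k : ℕ → ℕ
  k zero    = 0
  k (suc j) = Step.k (step (k j))
  n : ℕ → ℕ
  n j = 2 + Step.N (step (k (pred j)))
  u : ℕ → ℚ
  u j = + Step.c (step (k (pred j))) / suc (Step.D (step (k (pred j))) ∸ 1)
  k-increasing : ∀ j → 1 ≤ j → 1 ≤ k j × k j < k (suc j)
  k-increasing (suc j) _ = ≤-<-trans z≤n (Step.K<k (step (k j))) , Step.K<k (step (k (suc j)))
  t : ℕ → ℚ
  t j = (+ (p ^ k j) / 1) /ℚ (w *ℚ (u j ^ℚ (n j ∸ 2)))
  properties : ∀ j → 1 ≤ j →
    3 ≤ n j ×
    (Σ ℕ λ aj → Σ ℕ λ bj → (1 ≤ aj × 1 ≤ bj × u j ≡ (+ aj / suc (bj ∸ 1)) × gcd aj p ≡ 1 × p ^ m ∣ bj)) ×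
    (+ L / 1) <ℚ (w ⊓ u j ⊓ t j) ×
    w ⊔ u j ⊔ t j ≡ w
  properties (suc j) _ =
    s≤s (s≤s N>0) ,
    (c , D , ≤-trans (s≤s z≤n) L<u , D>0 , refl , gcd[c,p]≡1 , pᵐ∣D) ,
    x<y⇒x<z⇒x<y⊓z (x<y⇒x<z⇒x<y⊓z L<w L<uⱼ) (Q.L<t L L<t) ,
    y≤x⇒z≤x⇒x⊔y⊔z≡x (frac-≤ u≈c/D w≈a/B u≤w) (Q.t≤w t≤w)
    where
    open Step (step (k j)) hiding (k)
    instance
      c≢0 : NonZero c
      c≢0 = >-nonZero (≤-trans (s≤s z≤n) L<u)
    u≈c/D : Frac (u (suc j)) c D
    u≈c/D = subst (Frac (u (suc j)) c) (m+[n∸m]≡n D>0) (frac-/ c (D ∸ 1))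
    L<uⱼ : + L / 1 <ℚ u (suc j)
    L<uⱼ = frac-< (frac-/ L 0) u≈c/D (subst (L * D <_) (sym (*-identityʳ c)) L<u)
    module Q = Quotient w≈a/B u≈c/D (p ^ k (suc j)) N
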